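{- Let $T$ be a connected, complete and deterministic transducer with input alphabet $\{0,\dots,q-1\}$ and real outputs, and let $r$ be a nonnegative integer. Suppose that: (1) the input sequence $0^r$ is a reset sequence of $T$ leading to the initial state (i.e., reading $r$ zeros from any state ends in the initial state); (2) for every state $s$, the sum of the output labels along the path starting at $s$ with input $0^r$ equals the final output of $s$; (3) appending additional zeros at the end of the input sequence does not change the output sum. Then the function $n\mapsto(\text{output sum of }T\text{ on input }n)$ is $q$-quasiadditive with parameter $r$.
   Context: A transducer consists of finitely many states, an initial state, input alphabet $\{0,\dots,q-1\}$, transitions between states labelled $\varepsilon|\delta$ with input letter $\varepsilon$ and real output letter $\delta$, and a real final output for each state. It is complete and deterministic if for each state and each input letter there is exactly one transition leaving that state with that input label. On input $n$, the transducer reads the $q$-ary expansion of $n$ starting from the least significant digit, following the unique path from the initial state; the output sum is the sum of the output labels along this path plus the final output of the last state of the path. A function $f$ is $q$-quasiadditive with parameter $r$ if $f(q^{k+r}a+b)=f(a)+f(b)$ for all nonnegative integers $a,b,k$ with $0\le b<q^k$. -}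

module Defs where

open import Level using (Level)
open import Data.Nat using (ℕ; zero; suc; _+_; _*_; _^_; _<_)
open import Data.Nat.DivMod using (_/_; _mod_)
open import Data.Fin using (Fin)
open import Data.List using (List; []; _∷_; _++_; replicate)
open import Data.Product using (∃)
open import Relation.Binary.PropositionalEquality using (_≡_)
open import Algebra.Bundles using (AbelianGroup)

-- A complete deterministic transducer over input alphabet Fin q (= {0,…,q-1})
-- with outputs in (the carrier of) an abelian group G.
-- Completeness + determinism: the transition function is total.
record Transducer {c ℓ : Level} (G : AbelianGroup c ℓ) (q : ℕ) : Set c where
  open AbelianGroup G using (Carrier)
  field
    nStates : ℕ
    initial : Fin nStates
    next    : Fin nStates → Fin q → Fin nStates
    label   : Fin nStates → Fin q → Carrier
    final   : Fin nStates → Carrier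

module _ {c ℓ : Level} {G : AbelianGroup c ℓ} {q : ℕ} (T : Transducer G q) where
  open AbelianGroup G using (Carrier; _∙_; ε)
  open Transducer T

  State : Set
  State = Fin nStates

  endState : State → List (Fin q) → State
  endState s []       = s
  endState s (x ∷ w)  = endState (next s x) w

  pathOutput : State → List (Fin q) → Carrier
  pathOutput s []      = ε
  pathOutput s (x ∷ w) = label s x ∙ pathOutput (next s x) w

  outputSum : List (Fin q) → Carrier
  outputSum w = pathOutput initial w ∙ final (endState initial w)

  Connected : Set
  Connected = ∀ (s : State) → ∃ λ (w : List (Fin q)) → endState initial w ≡ s

-- q-ary expansion (least significant digit first, no leading zeros; 0 ↦ [])
-- for q = 2 + k. The fuel argument is at least the number of digits.
digitsFuel : (k : ℕ) → ℕ → ℕ → List (Fin (2 + k))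
digitsFuel k zero    n       = []
digitsFuel k (suc f) zero    = []
digitsFuel k (suc f) (suc n) = (suc n mod (2 + k)) ∷ digitsFuel k f (suc n / (2 + k))

digits : (k : ℕ) → ℕ → List (Fin (2 + k))
digits k n = digitsFuel k n n

transducerFun : {c ℓ : Level} {G : AbelianGroup c ℓ} {k : ℕ} →
                Transducer G (2 + k) → ℕ → AbelianGroup.Carrier G
transducerFun {k = k} T n = outputSum T (digits k n)

QuasiAdditive : {c ℓ : Level} (G : AbelianGroup c ℓ) (q r : ℕ) →
                (ℕ → AbelianGroup.Carrier G) → Set ℓ
QuasiAdditive G q r f =
  ∀ (a b k : ℕ) → b < q ^ k → f (q ^ (k + r) * a + b) ≈ f a ∙ f b
  where open AbelianGroup G using (_≈_; _∙_)

module Submission where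

-- Let q = 2 + k and write 0ʳ for the word of r zeros.  For
-- b < qʲ and a > 0 the q-ary expansion of q^(j+r)·a + b is the expansion of
-- b, padded with zeros up to length j, followed by 0ʳ and the expansion of a.
-- Hypotheses (1) and (2) say that 0ʳ resets the transducer: from any state s
-- it leads back to the initial state while producing exactly final s, so the
-- output sum of u ++ 0ʳ ++ v splits as the output sum of u plus that of v.
-- Hypothesis (3) removes the padding zeros after b, and (for u = v = [])
-- shows that f(0) is idempotent, hence the neutral element, which settles
-- the case a = 0.

open import Defs
open import Level using (Level)
open import Data.Nat using (ℕ; zero; suc; _+_; _*_; _^_; _<_; _≤_; z≤n; s≤s)
open import Data.Nat.DivMod
open import Data.Nat.Divisibility using (divides)
open import Data.Nat.Properties
open import Data.Fin using (Fin; zero)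
open import Data.Fin.Properties using (fromℕ<-cong)
open import Data.List using (List; []; _∷_; _++_; replicate)
open import Data.List.Properties using (++-assoc; ++-identityʳ)
open import Data.Product using (∃; _,_)
open import Relation.Binary.PropositionalEquality
  using (_≡_; refl; sym; trans; cong; cong₂; subst; module ≡-Reasoning)
open import Algebra.Bundles using (AbelianGroup)
import Algebra.Properties.Group as GroupProperties
import Relation.Binary.Reasoning.Setoid as SetoidReasoning

module Expansion (k : ℕ) where

  q : ℕ
  q = 2 + k

  -- Dividing a positive number by q makes it strictly smaller; this bounds
  -- the fuel needed by digitsFuel.
  quotient-≤ : ∀ n → suc n / q ≤ n
  quotient-≤ n = ≤-pred (m/n<m (suc n) q (s≤s (s≤s z≤n)))

  digitsFuel-zero : ∀ f → digitsFuel k f 0 ≡ []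
  digitsFuel-zero zero    = refl
  digitsFuel-zero (suc f) = refl

  digitsFuel-irrelevant : ∀ f g n → n ≤ f → n ≤ g → digitsFuel k f n ≡ digitsFuel k g n
  digitsFuel-irrelevant f g zero _ _ = trans (digitsFuel-zero f) (sym (digitsFuel-zero g))
  digitsFuel-irrelevant (suc f) (suc g) (suc n) (s≤s n≤f) (s≤s n≤g) =
    cong ((suc n mod q) ∷_)
      (digitsFuel-irrelevant f g (suc n / q) (≤-trans (quotient-≤ n) n≤f) (≤-trans (quotient-≤ n) n≤g))

  digits-unfold : ∀ n → 0 < n → digits k n ≡ (n mod q) ∷ digits k (n / q)
  digits-unfold (suc n) _ =
    cong ((suc n mod q) ∷_) (digitsFuel-irrelevant n (suc n / q) (suc n / q) (quotient-≤ n) ≤-refl)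

  padded : ℕ → ℕ → List (Fin q)
  padded zero    b = []
  padded (suc j) b = (b mod q) ∷ padded j (b / q)

  padded-zero : ∀ j → padded j 0 ≡ replicate j zero
  padded-zero zero    = refl
  padded-zero (suc j) = cong (zero ∷_) (padded-zero j)

  quotient-< : ∀ j b → b < q ^ suc j → b / q < q ^ j
  quotient-< j b b<q^1+j = m<n*o⇒m/o<n (subst (b <_) (*-comm q (q ^ j)) b<q^1+j)

  padded-+ : ∀ j r b → b < q ^ j → padded (j + r) b ≡ padded j b ++ replicate r zero
  padded-+ zero    r zero    _ = padded-zero r
  padded-+ zero    r (suc b) (s≤s ())
  padded-+ (suc j) r b b<q^j = cong ((b mod q) ∷_) (padded-+ j r (b / q) (quotient-< j b b<q^j))

  padded-digits : ∀ j b → b < q ^ j → ∃ λ m → padded j b ≡ digits k b ++ replicate m zero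
  padded-digits zero    zero    _ = 0 , refl
  padded-digits zero    (suc b) (s≤s ())
  padded-digits (suc j) zero    _ = suc j , padded-zero (suc j)
  padded-digits (suc j) (suc b) b<q^j with padded-digits j (suc b / q) (quotient-< j (suc b) b<q^j)
  ... | m , eq = m , (begin
      (suc b mod q) ∷ padded j (suc b / q)             ≡⟨ cong ((suc b mod q) ∷_) eq ⟩
      (suc b mod q) ∷ digits k (suc b / q) ++ zeros    ≡⟨ cong (_++ zeros) (sym (digits-unfold (suc b) (s≤s z≤n))) ⟩
      digits k (suc b) ++ zeros                        ∎)
    where
    open ≡-Reasoning
    zeros = replicate m zero

  mod-+-multiple : ∀ b c → (b + c * q) mod q ≡ b mod q
  mod-+-multiple b c = fromℕ<-cong _ _ ([m+kn]%n≡m%n b c q) _ _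

  div-+-multiple : ∀ b c → (b + c * q) / q ≡ c + b / q
  div-+-multiple b c = begin
    (b + c * q) / q    ≡⟨ +-distrib-/-∣ʳ b (divides c refl) ⟩
    b / q + c * q / q  ≡⟨ cong (b / q +_) (m*n/n≡m c q) ⟩
    b / q + c          ≡⟨ +-comm (b / q) c ⟩
    c + b / q          ∎
    where open ≡-Reasoning

  digits-shift : ∀ j a b → b < q ^ j → digits k (q ^ j * suc a + b) ≡ padded j b ++ digits k (suc a)
  digits-shift zero a zero _ = cong (digits k) (trans (+-identityʳ _) (*-identityˡ _))
  digits-shift zero a (suc b) (s≤s ())
  digits-shift (suc j) a b b<q^j = begin
    digits k n                                      ≡⟨ digits-unfold n n>0 ⟩
    (n mod q) ∷ digits k (n / q)                    ≡⟨ cong₂ _∷_ (cong (_mod q) n≡b+cq) (cong (λ m → digits k (m / q)) n≡b+cq) ⟩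
    ((b + c * q) mod q) ∷ digits k ((b + c * q) / q) ≡⟨ cong₂ _∷_ (mod-+-multiple b c) (cong (digits k) (div-+-multiple b c)) ⟩
    (b mod q) ∷ digits k (c + b / q)                ≡⟨ cong ((b mod q) ∷_) (digits-shift j a (b / q) (quotient-< j b b<q^j)) ⟩
    padded (suc j) b ++ digits k (suc a)            ∎
    where
    open ≡-Reasoning
    c = q ^ j * suc a
    n = q ^ suc j * suc a + b
    n≡b+cq : n ≡ b + c * q
    n≡b+cq = trans (+-comm _ b) (cong (b +_) (trans (*-assoc q (q ^ j) (suc a)) (*-comm q c)))
    n>0 : 0 < n
    n>0 = ≤-trans (m^n>0 q (suc j)) (≤-trans (m≤m*n (q ^ suc j) (suc a)) (m≤m+n _ b))

  digits-split : ∀ j r a b → b < q ^ j →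
    ∃ λ m → digits k (q ^ (j + r) * suc a + b) ≡
            (digits k b ++ replicate m zero) ++ (replicate r zero ++ digits k (suc a))
  digits-split j r a b b<q^j with padded-digits j b b<q^j
  ... | m , eq = m , (begin
      digits k (q ^ (j + r) * suc a + b)                     ≡⟨ digits-shift (j + r) a b b<q^j+r ⟩
      padded (j + r) b ++ digits k (suc a)                   ≡⟨ cong (_++ digits k (suc a)) (padded-+ j r b b<q^j) ⟩
      (padded j b ++ replicate r zero) ++ digits k (suc a)   ≡⟨ cong (λ u → (u ++ replicate r zero) ++ digits k (suc a)) eq ⟩
      ((digits k b ++ zeros) ++ replicate r zero) ++ digits k (suc a)
        ≡⟨ ++-assoc (digits k b ++ zeros) (replicate r zero) (digits k (suc a)) ⟩
      (digits k b ++ zeros) ++ (replicate r zero ++ digits k (suc a)) ∎)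
    where
    open ≡-Reasoning
    zeros = replicate m zero
    b<q^j+r : b < q ^ (j + r)
    b<q^j+r = ≤-trans b<q^j (^-monoʳ-≤ q (m≤m+n j r))

module Paths {c ℓ : Level} {G : AbelianGroup c ℓ} {q : ℕ} (T : Transducer G q) where
  open AbelianGroup G hiding (refl) renaming (sym to ≈-sym; trans to ≈-trans)
  open Transducer T

  endState-++ : ∀ s u v → endState T s (u ++ v) ≡ endState T (endState T s u) v
  endState-++ s []      v = refl
  endState-++ s (x ∷ u) v = endState-++ (next s x) u v

  pathOutput-++ : ∀ s u v → pathOutput T s (u ++ v) ≈ pathOutput T s u ∙ pathOutput T (endState T s u) v
  pathOutput-++ s []      v = ≈-sym (identityˡ _)
  pathOutput-++ s (x ∷ u) v = ≈-trans (∙-congˡ (pathOutput-++ (next s x) u v)) (≈-sym (assoc _ _ _))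

module ResetSequence {c ℓ : Level} (G : AbelianGroup c ℓ) {q : ℕ} (T : Transducer G q)
  (w : List (Fin q))
  (reset : ∀ s → endState T s w ≡ Transducer.initial T)
  (resetOutput : ∀ s → AbelianGroup._≈_ G (pathOutput T s w) (Transducer.final T s)) where

  open AbelianGroup G hiding (refl) renaming (sym to ≈-sym; trans to ≈-trans)
  open GroupProperties group using (identityˡ-unique)
  open Transducer T
  open Paths T
  open SetoidReasoning setoid

  outputSum-reset : ∀ u v → outputSum T (u ++ (w ++ v)) ≈ outputSum T u ∙ outputSum T v
  outputSum-reset u v = begin
      pathOutput T initial (u ++ (w ++ v)) ∙ final (endState T initial (u ++ (w ++ v)))
    ≈⟨ ∙-cong (pathOutput-++ initial u (w ++ v)) (reflexive (cong final end≡)) ⟩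
      (A ∙ pathOutput T s (w ++ v)) ∙ F
    ≈⟨ ∙-congʳ (∙-congˡ (pathOutput-++ s w v)) ⟩
      (A ∙ (pathOutput T s w ∙ pathOutput T (endState T s w) v)) ∙ F
    ≈⟨ ∙-congʳ (∙-congˡ (∙-cong (resetOutput s) (reflexive (cong (λ t → pathOutput T t v) (reset s))))) ⟩
      (A ∙ (final s ∙ B)) ∙ F
    ≈⟨ ∙-congʳ (≈-sym (assoc _ _ _)) ⟩
      ((A ∙ final s) ∙ B) ∙ F
    ≈⟨ assoc _ _ _ ⟩
      (A ∙ final s) ∙ (B ∙ F)
    ∎
    where
    s = endState T initial u
    A = pathOutput T initial u
    B = pathOutput T initial v
    F = final (endState T initial v)
    end≡ : endState T initial (u ++ (w ++ v)) ≡ endState T initial v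
    end≡ = trans (endState-++ initial u (w ++ v))
             (trans (endState-++ s w v) (cong (λ t → endState T t v) (reset s)))

  -- If the reset word alone has the same output sum as the empty word, then
  -- the output sum of the empty word is idempotent, hence neutral.
  outputSum-empty : outputSum T w ≈ outputSum T [] → outputSum T [] ≈ ε
  outputSum-empty w≈[] = identityˡ-unique y y (begin
    y ∙ y                 ≈⟨ ≈-sym (outputSum-reset [] []) ⟩
    outputSum T (w ++ []) ≈⟨ reflexive (cong (outputSum T) (++-identityʳ w)) ⟩
    outputSum T w         ≈⟨ w≈[] ⟩
    y                     ∎)
    where y = outputSum T []

proposition10 : ∀ {c ℓ : Level} (G : AbelianGroup c ℓ) (k : ℕ) (T : Transducer G (2 + k)) (r : ℕ) →
    Connected T →
    (∀ (s : Fin (Transducer.nStates T)) → endState T s (replicate r zero) ≡ Transducer.initial T) →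
    (∀ (s : Fin (Transducer.nStates T)) →
      AbelianGroup._≈_ G (pathOutput T s (replicate r zero)) (Transducer.final T s)) →
    (∀ (w : List (Fin (2 + k))) (m : ℕ) →
      AbelianGroup._≈_ G (outputSum T (w ++ replicate m zero)) (outputSum T w)) →
    QuasiAdditive G (2 + k) r (transducerFun T)
proposition10 G k T r _ reset resetOutput trailingZeros = quasiAdditive
  where
  open AbelianGroup G hiding (refl) renaming (sym to ≈-sym; trans to ≈-trans)
  open Expansion k
  open ResetSequence G T (replicate r zero) reset resetOutput
  open SetoidReasoning setoid
  f = transducerFun T

  f0≈ε : f 0 ≈ ε
  f0≈ε = outputSum-empty (trailingZeros [] r)

  quasiAdditive : QuasiAdditive G q r f
  quasiAdditive zero b j _ = begin
    f (q ^ (j + r) * 0 + b)  ≡⟨ cong (λ n → f (n + b)) (*-zeroʳ (q ^ (j + r))) ⟩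
    f b                      ≈⟨ ≈-sym (identityˡ _) ⟩
    ε ∙ f b                  ≈⟨ ∙-congʳ (≈-sym f0≈ε) ⟩
    f 0 ∙ f b                ∎
  quasiAdditive (suc a) b j b<q^j with digits-split j r a b b<q^j
  ... | m , split = begin
    f (q ^ (j + r) * suc a + b)                   ≡⟨ cong (outputSum T) split ⟩
    outputSum T ((digits k b ++ replicate m zero) ++ (replicate r zero ++ digits k (suc a)))
                                                  ≈⟨ outputSum-reset (digits k b ++ replicate m zero) (digits k (suc a)) ⟩
    outputSum T (digits k b ++ replicate m zero) ∙ f (suc a)
                                                  ≈⟨ ∙-congʳ (trailingZeros (digits k b) m) ⟩
    f b ∙ f (suc a)                               ≈⟨ comm _ _ ⟩
    f (suc a) ∙ f b                               ∎
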